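{- For any closed term $f:(\mathbb{N}\to\mathbb{N})\to\mathbb{N}$ of Gödel's System $\mathrm{T}$, we have $f^\mathrm{b}(\Omega)(\alpha)=f(\alpha)$ for all $\alpha:\mathbb{N}\to\mathbb{N}$, where $\Omega:\mathbb{N}^\mathrm{b}\to\mathbb{N}^\mathrm{b}$ is defined by $\Omega(g)(\alpha):\equiv\alpha(g\alpha)$.
   Context: Gödel's System $\mathrm{T}$: finite types are generated from the base type $\mathbb{N}$ by function types $\sigma\to\tau$. Terms are those of the simply typed lambda calculus (variables, $\lambda$-abstraction, application) extended with constants $0:\mathbb{N}$, $\mathrm{succ}:\mathbb{N}\to\mathbb{N}$ and, for each finite type $\rho$, $\mathrm{rec}_\rho:\rho\to(\mathbb{N}\to\rho\to\rho)\to\mathbb{N}\to\rho$ with $\mathrm{rec}(a)(f)(0)=a$ and $\mathrm{rec}(a)(f)(\mathrm{succ}\,n)=f(n)(\mathrm{rec}(a)(f)(n))$. The $\mathrm{b}$-translation: types are translated by $\mathbb{N}^\mathrm{b}:\equiv(\mathbb{N}\to\mathbb{N})\to\mathbb{N}$ and $(\sigma\to\tau)^\mathrm{b}:\equiv\sigma^\mathrm{b}\to\tau^\mathrm{b}$. Each variable $x:\rho$ is assigned a variable $x^\mathrm{b}:\rho^\mathrm{b}$, and terms are translated by $(x)^\mathrm{b}:\equiv x^\mathrm{b}$, $(\lambda x.u)^\mathrm{b}:\equiv\lambda x^\mathrm{b}.u^\mathrm{b}$, $(fa)^\mathrm{b}:\equiv f^\mathrm{b}a^\mathrm{b}$, $0^\mathrm{b}:\equiv\lambda\alpha.0$,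 $\mathrm{succ}^\mathrm{b}:\equiv\lambda f\alpha.\mathrm{succ}(f\alpha)$, $\mathrm{rec}^\mathrm{b}:\equiv\lambda af.\mathrm{ke}(\mathrm{rec}(a)(\lambda k.f(\lambda\alpha.k)))$, where $\mathrm{ke}_\rho:(\mathbb{N}\to\rho^\mathrm{b})\to\mathbb{N}^\mathrm{b}\to\rho^\mathrm{b}$ is defined by $\mathrm{ke}_\mathbb{N}(g)(f):\equiv\lambda\alpha.g(f\alpha)(\alpha)$ and $\mathrm{ke}_{\sigma\to\tau}(g)(f):\equiv\lambda x.\mathrm{ke}_\tau(\lambda k.g(k)(x))(f)$. Thus for $f:(\mathbb{N}\to\mathbb{N})\to\mathbb{N}$, $f^\mathrm{b}:(\mathbb{N}^\mathrm{b}\to\mathbb{N}^\mathrm{b})\to\mathbb{N}^\mathrm{b}$. -}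

module Defs where

open import Data.Nat using (ℕ; zero; suc)
open import Data.Unit using (⊤; tt)
open import Data.Product using (_×_; _,_)

infixr 5 _⇒_
data Ty : Set where
  ι   : Ty
  _⇒_ : Ty → Ty → Ty

infixl 4 _,_
data Ctx : Set where
  ε   : Ctx
  _,_ : Ctx → Ty → Ctx

data Var : Ctx → Ty → Set where
  vz : ∀ {Γ σ} → Var (Γ , σ) σ
  vs : ∀ {Γ σ τ} → Var Γ σ → Var (Γ , τ) σ

data Tm (Γ : Ctx) : Ty → Set where
  var  : ∀ {σ} → Var Γ σ → Tm Γ σ
  lam  : ∀ {σ τ} → Tm (Γ , σ) τ → Tm Γ (σ ⇒ τ)
  app  : ∀ {σ τ} → Tm Γ (σ ⇒ τ) → Tm Γ σ → Tm Γ τ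
  Zero : Tm Γ ι
  Succ : Tm Γ (ι ⇒ ι)
  Rec  : ∀ {ρ} → Tm Γ (ρ ⇒ (ι ⇒ ρ ⇒ ρ) ⇒ ι ⇒ ρ)

⟦_⟧ : Ty → Set
⟦ ι ⟧     = ℕ
⟦ σ ⇒ τ ⟧ = ⟦ σ ⟧ → ⟦ τ ⟧

Env : Ctx → Set
Env ε       = ⊤
Env (Γ , σ) = Env Γ × ⟦ σ ⟧

rec : {A : Set} → A → (ℕ → A → A) → ℕ → A
rec a f zero    = a
rec a f (suc n) = f n (rec a f n)

lookupV : ∀ {Γ σ} → Var Γ σ → Env Γ → ⟦ σ ⟧
lookupV vz     (γ , x) = x
lookupV (vs v) (γ , x) = lookupV v γ

eval : ∀ {Γ σ} → Tm Γ σ → Env Γ → ⟦ σ ⟧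
eval (var v)   γ = lookupV v γ
eval (lam t)   γ = λ x → eval t (γ , x)
eval (app t u) γ = eval t γ (eval u γ)
eval Zero      γ = zero
eval Succ      γ = suc
eval Rec       γ = rec

⟦_⟧₀ : ∀ {σ} → Tm ε σ → ⟦ σ ⟧
⟦ t ⟧₀ = eval t tt

_ᵇ : Ty → Ty
ι ᵇ       = (ι ⇒ ι) ⇒ ι
(σ ⇒ τ) ᵇ = σ ᵇ ⇒ τ ᵇ

ctxᵇ : Ctx → Ctx
ctxᵇ ε       = ε
ctxᵇ (Γ , σ) = ctxᵇ Γ , σ ᵇ

varᵇ : ∀ {Γ σ} → Var Γ σ → Var (ctxᵇ Γ) (σ ᵇ)
varᵇ vz     = vz
varᵇ (vs v) = vs (varᵇ v)

-- ke_ρ : (ℕ → ρᵇ) → ℕᵇ → ρᵇ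
-- ke_ℕ (g)(f) = λα. g (f α) α
-- ke_{σ→τ} (g)(f) = λx. ke_τ (λk. g k x) f
ke : ∀ {Γ} (ρ : Ty) → Tm Γ ((ι ⇒ ρ ᵇ) ⇒ ι ᵇ ⇒ ρ ᵇ)
ke ι       = lam (lam (lam (app (app (var (vs (vs vz))) (app (var (vs vz)) (var vz))) (var vz))))
ke (σ ⇒ τ) = lam (lam (lam (app (app (ke τ)
                 (lam (app (app (var (vs (vs (vs vz)))) (var vz)) (var (vs vz)))))
                 (var (vs vz)))))

tmᵇ : ∀ {Γ σ} → Tm Γ σ → Tm (ctxᵇ Γ) (σ ᵇ)
tmᵇ (var v)   = var (varᵇ v)
tmᵇ (lam t)   = lam (tmᵇ t)
tmᵇ (app t u) = app (tmᵇ t) (tmᵇ u)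
tmᵇ Zero      = lam Zero
tmᵇ Succ      = lam (lam (app Succ (app (var (vs vz)) (var vz))))
tmᵇ (Rec {ρ}) =                                                      -- λaf.ke(rec a (λk.f(λα.k)))
  lam (lam (app (ke ρ)
    (app (app Rec (var (vs vz))) (lam (app (var (vs vz)) (lam (var (vs vz))))))))

Ω : ⟦ ι ᵇ ⇒ ι ᵇ ⟧
Ω g α = α (g α)

module Submission where

-- Relate a b-value to a standard value by a logical relation whose base case says
-- that the generalized number x : ℕᵇ, evaluated at α, is the number n. Every term is
-- related to its b-translation (the fundamental lemma); the only non-routine case is rec,
-- where ke evaluates its generalized-number argument at α to select the recursion stage.
-- Since Ω is related to α itself, applying the fundamental lemma to f at Ω and α gives
-- f ᵇ Ω α = f α.

open import Defs
open import Data.Nat using (ℕ; zero; suc)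
open import Data.Unit using (⊤; tt)
open import Data.Product using (_×_; _,_)
open import Relation.Binary.PropositionalEquality using (_≡_; refl; cong)

module _ (α : ℕ → ℕ) where

  Related : (ρ : Ty) → ⟦ ρ ᵇ ⟧ → ⟦ ρ ⟧ → Set
  Related ι       x n = x α ≡ n
  Related (σ ⇒ τ) f g = ∀ x y → Related σ x y → Related τ (f x) (g y)

  RelatedEnv : (Γ : Ctx) → Env (ctxᵇ Γ) → Env Γ → Set
  RelatedEnv ε       _       _       = ⊤
  RelatedEnv (Γ , σ) (γ , x) (δ , y) = RelatedEnv Γ γ δ × Related σ x y

  lookupV-related : ∀ {Γ σ} (v : Var Γ σ) γ δ → RelatedEnv Γ γ δ →
                    Related σ (lookupV (varᵇ v) γ) (lookupV v δ)
  lookupV-related vz     (γ , x) (δ , y) (_  , x~y) = x~y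
  lookupV-related (vs v) (γ , x) (δ , y) (γ~δ , _)  = lookupV-related v γ δ γ~δ

  ke-related : ∀ ρ {Γ} (γ : Env Γ) (g : ℕ → ⟦ ρ ᵇ ⟧) (h : ℕ → ⟦ ρ ⟧) →
               (∀ k → Related ρ (g k) (h k)) →
               Related (ι ⇒ ρ) (eval (ke ρ) γ g) h
  ke-related ι       γ g h g~h x .(x α) refl = g~h (x α)
  ke-related (σ ⇒ τ) γ g h g~h x n x~n y z y~z =
    ke-related τ _ (λ k → g k y) (λ k → h k z) (λ k → g~h k y z y~z) x n x~n

  rec-related : ∀ ρ a a' f f' → Related ρ a a' → Related (ι ⇒ ρ ⇒ ρ) f f' →
                ∀ k → Related ρ (rec a (λ k → f (λ _ → k)) k) (rec a' f' k)
  rec-related ρ a a' f f' a~a' f~f' zero    = a~a'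
  rec-related ρ a a' f f' a~a' f~f' (suc k) =
    f~f' (λ _ → k) k refl _ _ (rec-related ρ a a' f f' a~a' f~f' k)

  eval-tmᵇ-related : ∀ {Γ σ} (t : Tm Γ σ) γ δ → RelatedEnv Γ γ δ →
                     Related σ (eval (tmᵇ t) γ) (eval t δ)
  eval-tmᵇ-related (var v)   γ δ γ~δ = lookupV-related v γ δ γ~δ
  eval-tmᵇ-related (lam t)   γ δ γ~δ x y x~y = eval-tmᵇ-related t (γ , x) (δ , y) (γ~δ , x~y)
  eval-tmᵇ-related (app t u) γ δ γ~δ =
    eval-tmᵇ-related t γ δ γ~δ _ _ (eval-tmᵇ-related u γ δ γ~δ)
  eval-tmᵇ-related Zero      γ δ γ~δ = refl
  eval-tmᵇ-related Succ      γ δ γ~δ x n x~n = cong suc x~n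
  eval-tmᵇ-related (Rec {ρ}) γ δ γ~δ a a' a~a' f f' f~f' =
    ke-related ρ _ (rec a (λ k → f (λ _ → k))) (rec a' f') (rec-related ρ a a' f f' a~a' f~f')

  Ω-related : Related (ι ⇒ ι) Ω α
  Ω-related x n x~n = cong α x~n

theorem2p5 : (f : Tm ε ((ι ⇒ ι) ⇒ ι)) (α : ℕ → ℕ) →
    ⟦ tmᵇ f ⟧₀ Ω α ≡ ⟦ f ⟧₀ α
theorem2p5 f α = eval-tmᵇ-related α f tt tt tt Ω α (Ω-related α)
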